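{- Let $k$ be a field and let $f\in k[x_1,\dots,x_n]$ and $g\in k[y_1,\dots,y_m]$ be polynomials in disjoint sets of variables, both vanishing at the origin. Then, viewing $f+g$ and $fg$ in $k[x,y]$ and $f(x_1,\dots,x_{n-1},x_{n-1})$ in $k[x_1,\dots,x_{n-1}]$: (i) $\sigma(f+g)=\sigma(f)+\sigma(g)$; (ii) $\sigma(fg)=\min\{\sigma(f),\sigma(g)\}$; (iii) if $n\ge2$ then $\sigma(f)\ge\sigma(f(x_1,\dots,x_{n-1},x_{n-1}))$.
   Context: For non-zero $h=\sum_ic_ix^i$ in $r$ variables, $\Delta_0(h)=\mathrm{conv}\{i:c_i\ne0\}+\mathbb{R}_{\ge0}^r$ is its Newton polyhedron at the origin, and $\sigma(h)\in\mathbb{Q}_{>0}\cup\{+\infty\}$ is defined by $1/\sigma(h)=\min\{t\ge0:(t,\dots,t)\in\Delta_0(h)\}$ (so $(1/\sigma(h),\dots,1/\sigma(h))$ is the point where the diagonal first meets $\Delta_0(h)$; $\sigma(h)=+\infty$ if the minimum is $0$). By convention $\sigma(0)=0$. This value does not change if $h$ is viewed in a polynomial ring with additional variables. -}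

module Defs where

open import Level using (Level; _⊔_) renaming (suc to lsuc)
open import Algebra.Bundles using (CommutativeRing)
open import Data.Nat as ℕ using (ℕ)
open import Data.Integer using (+_)
open import Data.Rational as ℚ using (ℚ; 0ℚ; 1ℚ; _/_)
open import Data.Fin using (Fin)
open import Data.Vec as Vec using (Vec; []; _∷_; _++_; replicate; lookup; zipWith)
open import Data.Vec.Properties using (≡-dec)
open import Data.List as List using (List; []; _∷_)
open import Data.List.Relation.Unary.All using (All)
open import Data.Product using (Σ; ∃; _×_; _,_; proj₁; proj₂)
open import Relation.Nullary using (¬_; yes; no)
open import Relation.Binary.PropositionalEquality using (_≡_)

record Field (c ℓ : Level) : Set (lsuc (c ⊔ ℓ)) where
  field
    commutativeRing : CommutativeRing c ℓ
  open CommutativeRing commutativeRing public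
  field
    0≉1     : ¬ (0# ≈ 1#)
    inverse : ∀ x → ¬ (x ≈ 0#) → ∃ λ y → x * y ≈ 1#

-- Polynomials in r variables over a field k, as finite formal sums of
-- terms  c · x^e  (c ∈ k, e ∈ ℕ^r).  Two representations denote the same
-- polynomial iff all their coefficients agree (up to ≈).

module Poly {c ℓ} (k : Field c ℓ) where
  open Field k

  Exp : ℕ → Set
  Exp r = Vec ℕ r

  Pol : ℕ → Set c
  Pol r = List (Carrier × Exp r)

  coeff : ∀ {r} → Pol r → Exp r → Carrier
  coeff []              e = 0#
  coeff ((a , d) ∷ h) e with ≡-dec ℕ._≟_ d e
  ... | yes _ = a + coeff h e
  ... | no  _ = coeff h e

  _⊕_ : ∀ {r} → Pol r → Pol r → Pol r
  _⊕_ = List._++_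

  _⊗_ : ∀ {r} → Pol r → Pol r → Pol r
  h ⊗ h' = List.concatMap (λ { (a , d) → List.map (λ { (b , d') → (a * b , zipWith ℕ._+_ d d') }) h' }) h

  mapExp : ∀ {r s} → (Exp r → Exp s) → Pol r → Pol s
  mapExp φ = List.map (λ { (a , d) → (a , φ d) })

  inclX : ∀ {n} m → Pol n → Pol (n ℕ.+ m)
  inclX m = mapExp (λ d → d ++ replicate m 0)

  inclY : ∀ n {m} → Pol m → Pol (n ℕ.+ m)
  inclY n = mapExp (λ d → replicate n 0 ++ d)

  -- exponent effect of substituting xₙ := xₙ₋₁ (merge the last two entries)
  mergeLast : ∀ {n} → Exp (ℕ.suc (ℕ.suc n)) → Exp (ℕ.suc n)
  mergeLast {ℕ.zero} (a ∷ b ∷ []) = (a ℕ.+ b) ∷ []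
  mergeLast {ℕ.suc n} (a ∷ d)     = a ∷ mergeLast d

  substLast : ∀ {n} → Pol (ℕ.suc (ℕ.suc n)) → Pol (ℕ.suc n)
  substLast = mapExp mergeLast

  IsZeroPol : ∀ {r} → Pol r → Set ℓ
  IsZeroPol h = ∀ e → coeff h e ≈ 0#

  VanishesAt0 : ∀ {r} → Pol r → Set ℓ
  VanishesAt0 {r} h = coeff h (replicate r 0) ≈ 0#

  -- Newton polyhedron Δ₀(h) = conv{ e : c_e ≠ 0 } + ℝ^r_{≥0}
  -- (membership of rational points; rational convex weights suffice
  -- since Δ₀(h) is a rational polyhedron).

  toℚ : ℕ → ℚ
  toℚ n = + n / 1

  sumℚ : List ℚ → ℚ
  sumℚ = List.foldr ℚ._+_ 0ℚ

  InNewton : ∀ {r} → Pol r → Vec ℚ r → Set ℓ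
  InNewton {r} h v =
    Σ (List (ℚ × Exp r)) λ ws →
        All (λ { (w , e) → (0ℚ ℚ.≤ w) × ¬ (coeff h e ≈ 0#) }) ws
      × sumℚ (List.map proj₁ ws) ≡ 1ℚ
      × (∀ (i : Fin r) →
           sumℚ (List.map (λ { (w , e) → w ℚ.* toℚ (lookup e i) }) ws) ℚ.≤ lookup v i)

  diag : ∀ r → ℚ → Vec ℚ r
  diag r t = replicate r t

  IsMinDiag : ∀ {r} → Pol r → ℚ → Set ℓ
  IsMinDiag {r} h t =
      (0ℚ ℚ.≤ t) × InNewton h (diag r t)
    × (∀ t' → 0ℚ ℚ.≤ t' → InNewton h (diag r t') → t ℚ.≤ t')

  data ℚ∞ : Set where
    fin : ℚ → ℚ∞
    ∞   : ℚ∞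

  _+∞_ : ℚ∞ → ℚ∞ → ℚ∞
  fin p +∞ fin q = fin (p ℚ.+ q)
  fin _ +∞ ∞     = ∞
  ∞     +∞ _     = ∞

  min∞ : ℚ∞ → ℚ∞ → ℚ∞
  min∞ (fin p) (fin q) = fin (p ℚ.⊓ q)
  min∞ (fin p) ∞       = fin p
  min∞ ∞       s       = s

  data _≤∞_ : ℚ∞ → ℚ∞ → Set where
    fin≤fin : ∀ {p q} → p ℚ.≤ q → fin p ≤∞ fin q
    ≤∞-top  : ∀ {s} → s ≤∞ ∞

  -- σ(h) = s, as a relation:
  --   σ(0) = 0;  for h ≠ 0,  1/σ(h) = min{t ≥ 0 : (t,…,t) ∈ Δ₀(h)},
  --   with σ(h) = +∞ when that minimum is 0.
  data HasSigma {r} (h : Pol r) : ℚ∞ → Set (c ⊔ ℓ) where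
    σ-zero : IsZeroPol h → HasSigma h (fin 0ℚ)
    σ-inf  : ∀ {e} → ¬ (coeff h e ≈ 0#) → IsMinDiag h 0ℚ → HasSigma h ∞
    σ-fin  : ∀ {e t q} → ¬ (coeff h e ≈ 0#) → IsMinDiag h t →
             ¬ (t ≡ 0ℚ) → t ℚ.* q ≡ 1ℚ → HasSigma h (fin q)

module Submission where

open import Level using (Level)
open import Data.Nat using (ℕ; suc; _+_)
open import Data.Product using (_×_)
open import Defs
open import Data.Nat as ℕ using (zero)
import Data.Nat.Properties as ℕP
import Data.Nat.Coprimality as Coprime
open import Data.Integer as ℤ using (+_)
import Data.Integer.Properties as ℤP
open import Data.Rational using (ℚ; 0ℚ; 1ℚ; mkℚ)
import Data.Rational as ℚ
import Data.Rational.Properties as ℚP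
open import Data.Product using (Σ; _,_; proj₁; proj₂)
open import Data.Sum using (_⊎_; inj₁; inj₂; [_,_]′)
open import Data.Empty using (⊥-elim)
open import Data.Maybe using (Maybe; just; nothing)
open import Data.Fin using (Fin; zero; suc; splitAt; _↑ˡ_; _↑ʳ_)
open import Data.Vec as Vec using (Vec; []; _∷_; _++_; lookup; replicate; zipWith)
open import Data.Vec.Properties using (lookup-replicate; lookup-++ˡ; lookup-++ʳ; ++-injectiveˡ; ++-injectiveʳ; ≡-dec)
open import Data.List as List using (List; []; _∷_; cartesianProductWith)
import Data.List.Properties as ListP
open import Data.List.Relation.Unary.All as All using (All; []; _∷_)
import Data.List.Relation.Unary.All.Properties as AllP
open import Function using (_∘_; Injective)
open import Relation.Nullary using (¬_; yes; no)
open import Relation.Nullary.Decidable using (decidable-stable)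
open import Relation.Binary.PropositionalEquality
import Relation.Binary.Reasoning.Setoid

-- The three claims are then proved in `SigmaOfSum`, `SigmaOfProduct`, `SigmaOfSubstitution`:
-- (i)   for σf, σg finite the diagonal minimum of f+g is t = 1/(σf+σg): the f- and
--       g-witnesses combined with weights t·σf, t·σg reach (t,…,t), and a witness for f+g
--       splits into an f-part and a g-part of weights Λf + Λg = 1 with Λf ≤ t′σf, Λg ≤ t′σg;
-- (ii)  the product of the f- and g-witnesses reaches max(tf, tg), and a witness for fg
--       projects to witnesses for f and for g;
-- (iii) merging coordinates only enlarges them, so the diagonal minimum of f is at most
--       that of the substituted polynomial.

module RationalArithmetic where
  open Data.Rational using (_≤_; _<_; _*_) renaming (_+_ to _+ℚ_)

  sumℚ : List ℚ → ℚ
  sumℚ = List.foldr ℚ._+_ 0ℚ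

  toℚ : ℕ → ℚ
  toℚ n = + n ℚ./ 1

  -- `toℚ n` in normal form, which makes it comparable numerator-wise
  toℚ-normal : ∀ n → toℚ n ≡ mkℚ (+ n) 0 (Coprime.sym (Coprime.1-coprimeTo n))
  toℚ-normal n = ℚP.normalize-coprime (Coprime.sym (Coprime.1-coprimeTo n))

  toℚ-mono : ∀ {a b} → a ℕ.≤ b → toℚ a ≤ toℚ b
  toℚ-mono {a} {b} a≤b rewrite toℚ-normal a | toℚ-normal b =
    ℚ.*≤* (subst₂ ℤ._≤_ (sym (ℤP.*-identityʳ (+ a))) (sym (ℤP.*-identityʳ (+ b))) (ℤ.+≤+ a≤b))

  toℚ-nonneg : ∀ n → 0ℚ ≤ toℚ n
  toℚ-nonneg n = toℚ-mono {0} {n} ℕ.z≤n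

  *-monoˡ-≤-nonneg : ∀ {r p q} → 0ℚ ≤ r → p ≤ q → r * p ≤ r * q
  *-monoˡ-≤-nonneg {r} 0≤r = ℚP.*-monoˡ-≤-nonNeg r {{ℚ.nonNegative 0≤r}}

  *-monoʳ-≤-nonneg : ∀ {r p q} → 0ℚ ≤ r → p ≤ q → p * r ≤ q * r
  *-monoʳ-≤-nonneg {r} 0≤r = ℚP.*-monoʳ-≤-nonNeg r {{ℚ.nonNegative 0≤r}}

  *-nonneg : ∀ {a b} → 0ℚ ≤ a → 0ℚ ≤ b → 0ℚ ≤ a * b
  *-nonneg {a} {b} 0≤a 0≤b = subst (_≤ a * b) (ℚP.*-zeroˡ b) (*-monoʳ-≤-nonneg 0≤b 0≤a)

  module _ {a} {A : Set a} where
    sumℚ-++ : (F : A → ℚ) (xs ys : List A) →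
              sumℚ (List.map F (xs List.++ ys)) ≡ sumℚ (List.map F xs) +ℚ sumℚ (List.map F ys)
    sumℚ-++ F []       ys = sym (ℚP.+-identityˡ _)
    sumℚ-++ F (x ∷ xs) ys = trans (cong (F x +ℚ_) (sumℚ-++ F xs ys)) (sym (ℚP.+-assoc (F x) _ _))

    sumℚ-cong : (F G : A → ℚ) (xs : List A) → (∀ x → F x ≡ G x) →
                sumℚ (List.map F xs) ≡ sumℚ (List.map G xs)
    sumℚ-cong F G xs F≗G = cong sumℚ (ListP.map-cong F≗G xs)

    sumℚ-scale : (F : A → ℚ) (c : ℚ) (xs : List A) →
                 sumℚ (List.map (λ x → c * F x) xs) ≡ c * sumℚ (List.map F xs)
    sumℚ-scale F c []       = sym (ℚP.*-zeroʳ c)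
    sumℚ-scale F c (x ∷ xs) =
      trans (cong (c * F x +ℚ_) (sumℚ-scale F c xs)) (sym (ℚP.*-distribˡ-+ c (F x) _))

    sumℚ-nonneg : (F : A → ℚ) (xs : List A) → All (λ x → 0ℚ ≤ F x) xs → 0ℚ ≤ sumℚ (List.map F xs)
    sumℚ-nonneg F []       []         = ℚP.≤-refl
    sumℚ-nonneg F (x ∷ xs) (0≤ ∷ 0≤s) = ℚP.+-mono-≤ 0≤ (sumℚ-nonneg F xs 0≤s)

    sumℚ-zero : (xs : List A) → sumℚ (List.map (λ _ → 0ℚ) xs) ≡ 0ℚ
    sumℚ-zero []       = refl
    sumℚ-zero (x ∷ xs) = trans (ℚP.+-identityˡ _) (sumℚ-zero xs)

  sumℚ-cartesian : ∀ {a b c} {A : Set a} {B : Set b} {C : Set c}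
    (f : A → B → C) (H : C → ℚ) (F : A → ℚ) (G : B → ℚ) → (∀ x y → H (f x y) ≡ F x * G y) →
    ∀ xs ys → sumℚ (List.map H (cartesianProductWith f xs ys)) ≡ sumℚ (List.map F xs) * sumℚ (List.map G ys)
  sumℚ-cartesian f H F G H≡ []       ys = sym (ℚP.*-zeroˡ (sumℚ (List.map G ys)))
  sumℚ-cartesian f H F G H≡ (x ∷ xs) ys = begin
    sumℚ (List.map H (List.map (f x) ys List.++ cartesianProductWith f xs ys))
      ≡⟨ sumℚ-++ H (List.map (f x) ys) _ ⟩
    sumℚ (List.map H (List.map (f x) ys)) +ℚ sumℚ (List.map H (cartesianProductWith f xs ys))
      ≡⟨ cong₂ _+ℚ_ row (sumℚ-cartesian f H F G H≡ xs ys) ⟩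
    F x * ΣG +ℚ sumℚ (List.map F xs) * ΣG
      ≡⟨ sym (ℚP.*-distribʳ-+ ΣG (F x) _) ⟩
    (F x +ℚ sumℚ (List.map F xs)) * ΣG ∎
    where
    open ≡-Reasoning
    ΣG = sumℚ (List.map G ys)
    row : sumℚ (List.map H (List.map (f x) ys)) ≡ F x * ΣG
    row = trans (cong sumℚ (sym (ListP.map-∘ ys)))
                (trans (sumℚ-cong (H ∘ f x) (λ y → F x * G y) ys (H≡ x)) (sumℚ-scale G (F x) ys))

  0<1 : 0ℚ < 1ℚ
  0<1 = ℚ.*<* (ℤ.+<+ (ℕ.s≤s ℕ.z≤n))

  -- σ = q is stored through t·q = 1; such a q is positive when t ≥ 0 ...
  reciprocal-pos : ∀ {t q} → 0ℚ ≤ t → t * q ≡ 1ℚ → 0ℚ < q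
  reciprocal-pos {t} {q} 0≤t tq≡1 with q ℚP.≤? 0ℚ
  ... | no  q≰0 = ℚP.≰⇒> q≰0
  ... | yes q≤0 = ⊥-elim (ℚP.<-irrefl refl (ℚP.<-≤-trans 0<1 1≤0))
    where
    1≤0 : 1ℚ ≤ 0ℚ
    1≤0 = subst₂ _≤_ tq≡1 (ℚP.*-zeroʳ t) (*-monoˡ-≤-nonneg 0≤t q≤0)

  reciprocal-antitone : ∀ {t₁ q₁ t₂ q₂} → 0ℚ ≤ t₁ → t₁ * q₁ ≡ 1ℚ → t₂ * q₂ ≡ 1ℚ →
                        t₁ ≤ t₂ → q₂ ≤ q₁
  reciprocal-antitone {t₁} {q₁} {t₂} {q₂} 0≤t₁ e₁ e₂ t₁≤t₂ = begin
    q₂                ≡⟨ sym (ℚP.*-identityʳ q₂) ⟩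
    q₂ * 1ℚ           ≡⟨ cong (q₂ *_) (sym e₁) ⟩
    q₂ * (t₁ * q₁)    ≡⟨ sym (ℚP.*-assoc q₂ t₁ q₁) ⟩
    (q₂ * t₁) * q₁    ≤⟨ *-monoʳ-≤-nonneg 0≤q₁ (*-monoˡ-≤-nonneg 0≤q₂ t₁≤t₂) ⟩
    (q₂ * t₂) * q₁    ≡⟨ cong (_* q₁) (trans (ℚP.*-comm q₂ t₂) e₂) ⟩
    1ℚ * q₁           ≡⟨ ℚP.*-identityˡ q₁ ⟩
    q₁                ∎
    where
    open ℚP.≤-Reasoning
    0≤q₁ = ℚP.<⇒≤ (reciprocal-pos 0≤t₁ e₁)
    0≤q₂ = ℚP.<⇒≤ (reciprocal-pos (ℚP.≤-trans 0≤t₁ t₁≤t₂) e₂)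

  reciprocal-antitone⁻¹ : ∀ {t₁ q₁ t₂ q₂} → 0ℚ ≤ t₁ → t₁ * q₁ ≡ 1ℚ → t₂ * q₂ ≡ 1ℚ →
                          q₁ ≤ q₂ → t₂ ≤ t₁
  reciprocal-antitone⁻¹ {t₁} {q₁} {t₂} {q₂} 0≤t₁ e₁ e₂ =
    reciprocal-antitone (ℚP.<⇒≤ (reciprocal-pos 0≤t₁ e₁)) (trans (ℚP.*-comm q₁ t₁) e₁) (trans (ℚP.*-comm q₂ t₂) e₂)

  divide-by-reciprocal : ∀ {Λ t q t′} → t * q ≡ 1ℚ → 0ℚ ≤ q → Λ * t ≤ t′ → Λ ≤ t′ * q
  divide-by-reciprocal {Λ} {t} {q} {t′} tq≡1 0≤q Λt≤t′ = begin
    Λ              ≡⟨ sym (ℚP.*-identityʳ Λ) ⟩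
    Λ * 1ℚ         ≡⟨ cong (Λ *_) (sym tq≡1) ⟩
    Λ * (t * q)    ≡⟨ sym (ℚP.*-assoc Λ t q) ⟩
    (Λ * t) * q    ≤⟨ *-monoʳ-≤-nonneg 0≤q Λt≤t′ ⟩
    t′ * q         ∎
    where open ℚP.≤-Reasoning

  below-reciprocal : ∀ {t q t′} → t * q ≡ 1ℚ → 0ℚ ≤ t → 1ℚ ≤ t′ * q → t ≤ t′
  below-reciprocal {t} {q} {t′} tq≡1 0≤t 1≤t′q = begin
    t                  ≡⟨ sym (ℚP.*-identityʳ t) ⟩
    t * 1ℚ             ≤⟨ *-monoˡ-≤-nonneg 0≤t 1≤t′q ⟩
    t * (t′ * q)       ≡⟨ trans (sym (ℚP.*-assoc t t′ q)) (cong (_* q) (ℚP.*-comm t t′)) ⟩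
    (t′ * t) * q       ≡⟨ trans (ℚP.*-assoc t′ t q) (cong (t′ *_) tq≡1) ⟩
    t′ * 1ℚ            ≡⟨ ℚP.*-identityʳ t′ ⟩
    t′                 ∎
    where open ℚP.≤-Reasoning

  cancel-reciprocal : ∀ {s q} t → s * q ≡ 1ℚ → (t * q) * s ≡ t
  cancel-reciprocal {s} {q} t sq≡1 =
    trans (ℚP.*-assoc t q s) (trans (cong (t *_) (trans (ℚP.*-comm q s) sq≡1)) (ℚP.*-identityʳ t))

  reciprocal-nonzero : ∀ {t q} → t * q ≡ 1ℚ → t ≢ 0ℚ
  reciprocal-nonzero {t} {q} tq≡1 refl = ℚP.<⇒≢ 0<1 (trans (sym (ℚP.*-zeroˡ q)) tq≡1)

  reciprocal : ∀ Λ → 0ℚ < Λ → Σ ℚ λ L → Λ * L ≡ 1ℚ × 0ℚ ≤ L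
  reciprocal Λ 0<Λ = ℚ.1/ Λ , Λ/Λ≡1 , ℚP.<⇒≤ (reciprocal-pos (ℚP.<⇒≤ 0<Λ) Λ/Λ≡1)
    where
    instance _ = ℚP.pos⇒nonZero Λ {{ℚ.positive 0<Λ}}
    Λ/Λ≡1 = ℚP.*-inverseʳ Λ

lookup-++-splitAt : ∀ {a} {A : Set a} {n m} (x : Vec A n) (y : Vec A m) i →
                    lookup (x ++ y) i ≡ [ lookup x , lookup y ]′ (splitAt n i)
lookup-++-splitAt []      y i       = refl
lookup-++-splitAt (a ∷ x) y zero    = refl
lookup-++-splitAt {n = suc n} (a ∷ x) y (suc i) with splitAt n i | lookup-++-splitAt x y i
... | inj₁ j | lookup-x∙y = lookup-x∙y
... | inj₂ j | lookup-x∙y = lookup-x∙y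

¬¬-all : ∀ {a p} {A : Set a} {P : A → Set p} (xs : List A) → All (λ x → ¬ ¬ P x) xs → ¬ ¬ All P xs
¬¬-all []       []           all-false = all-false []
¬¬-all (x ∷ xs) (¬¬px ∷ ¬¬ps) all-false = ¬¬px (λ px → ¬¬-all xs ¬¬ps (λ ps → all-false (px ∷ ps)))

module SupportCalculus {c ℓ} (k : Field c ℓ) where
  open Field k using (Carrier; _≈_; 0#; 1#) renaming (_+_ to _+ₖ_; _*_ to _*ₖ_)
  module K = Field k
  module ≈-Reasoning = Relation.Binary.Reasoning.Setoid K.setoid
  open Poly k

  NonZero : Carrier → Set ℓ
  NonZero a = ¬ (a ≈ 0#)

  nonzero-resp : ∀ {a b} → a ≈ b → NonZero a → NonZero b
  nonzero-resp a≈b a≉0 b≈0 = a≉0 (K.trans a≈b b≈0)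

  nonzero-*ˡ : ∀ a b → NonZero (a *ₖ b) → NonZero a
  nonzero-*ˡ a b ab≉0 a≈0 = ab≉0 (K.trans (K.*-congʳ a≈0) (K.zeroˡ b))

  nonzero-*ʳ : ∀ a b → NonZero (a *ₖ b) → NonZero b
  nonzero-*ʳ a b ab≉0 b≈0 = ab≉0 (K.trans (K.*-congˡ b≈0) (K.zeroʳ a))

  nonzero-* : ∀ a b → NonZero a → NonZero b → NonZero (a *ₖ b)
  nonzero-* a b a≉0 b≉0 ab≈0 with K.inverse a a≉0
  ... | a⁻¹ , aa⁻¹≈1 = b≉0 (begin
    b                    ≈⟨ K.sym (K.*-identityˡ b) ⟩
    1# *ₖ b              ≈⟨ K.*-congʳ (K.sym aa⁻¹≈1) ⟩
    (a *ₖ a⁻¹) *ₖ b      ≈⟨ K.*-congʳ (K.*-comm a a⁻¹) ⟩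
    (a⁻¹ *ₖ a) *ₖ b      ≈⟨ K.*-assoc a⁻¹ a b ⟩
    a⁻¹ *ₖ (a *ₖ b)      ≈⟨ K.*-congˡ ab≈0 ⟩
    a⁻¹ *ₖ 0#            ≈⟨ K.zeroʳ a⁻¹ ⟩
    0#                   ∎)
    where open ≈-Reasoning

  zeros : ∀ n → Exp n
  zeros n = replicate n 0

  coeff-⊕ : ∀ {r} (h h' : Pol r) e → coeff (h ⊕ h') e ≈ coeff h e +ₖ coeff h' e
  coeff-⊕ []            h' e = K.sym (K.+-identityˡ _)
  coeff-⊕ ((a , d) ∷ h) h' e with ≡-dec ℕ._≟_ d e
  ... | yes _ = K.trans (K.+-congˡ (coeff-⊕ h h' e)) (K.sym (K.+-assoc _ _ _))
  ... | no  _ = coeff-⊕ h h' e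

  -- Σ σ(a_d)·x^{ψ d}: rename the exponents by ψ and apply σ to the coefficients.
  -- `mapExp ψ` is `mapTerms (λ a → a) ψ`, and one row of a product is such a map.
  mapTerms : ∀ {r s} → (Carrier → Carrier) → (Exp r → Exp s) → Pol r → Pol s
  mapTerms σ ψ = List.map (λ (a , d) → (σ a , ψ d))

  coeff-mapTerms-image : ∀ {r s} (σ : Carrier → Carrier) (ψ : Exp r → Exp s) →
    (∀ a b → σ (a +ₖ b) ≈ σ a +ₖ σ b) → σ 0# ≈ 0# → Injective _≡_ _≡_ ψ →
    ∀ h d → coeff (mapTerms σ ψ h) (ψ d) ≈ σ (coeff h d)
  coeff-mapTerms-image σ ψ σ-+ σ-0 inj [] d = K.sym σ-0
  coeff-mapTerms-image σ ψ σ-+ σ-0 inj ((a , d′) ∷ h) d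
    with ≡-dec ℕ._≟_ (ψ d′) (ψ d) | ≡-dec ℕ._≟_ d′ d
  ... | yes _   | yes _   = K.trans (K.+-congˡ (coeff-mapTerms-image σ ψ σ-+ σ-0 inj h d)) (K.sym (σ-+ a _))
  ... | yes ψ≡  | no  d≢  = ⊥-elim (d≢ (inj ψ≡))
  ... | no  ψ≢  | yes d≡  = ⊥-elim (ψ≢ (cong ψ d≡))
  ... | no  _   | no  _   = coeff-mapTerms-image σ ψ σ-+ σ-0 inj h d

  coeff-mapTerms-outside : ∀ {r s} (σ : Carrier → Carrier) (ψ : Exp r → Exp s) h e →
    (∀ d → ψ d ≢ e) → coeff (mapTerms σ ψ h) e ≈ 0#
  coeff-mapTerms-outside σ ψ []            e ∉im = K.refl
  coeff-mapTerms-outside σ ψ ((a , d) ∷ h) e ∉im with ≡-dec ℕ._≟_ (ψ d) e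
  ... | yes ψd≡e = ⊥-elim (∉im d ψd≡e)
  ... | no  _    = coeff-mapTerms-outside σ ψ h e ∉im

  coeff-mapExp-injective : ∀ {r s} (ψ : Exp r → Exp s) → Injective _≡_ _≡_ ψ →
    ∀ h d → coeff (mapExp ψ h) (ψ d) ≈ coeff h d
  coeff-mapExp-injective ψ = coeff-mapTerms-image (λ a → a) ψ (λ _ _ → K.refl) K.refl

  coeff-inclX : ∀ {n} m (f : Pol n) x → coeff (inclX m f) (x ++ zeros m) ≈ coeff f x
  coeff-inclX m f = coeff-mapExp-injective (_++ zeros m) (++-injectiveˡ _ _) f

  coeff-inclY : ∀ n {m} (g : Pol m) y → coeff (inclY n g) (zeros n ++ y) ≈ coeff g y
  coeff-inclY n g = coeff-mapExp-injective (zeros n ++_) (++-injectiveʳ (zeros n) (zeros n)) g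

  coeff-inclX-outside : ∀ {n} m (f : Pol n) x y → y ≢ zeros m → coeff (inclX m f) (x ++ y) ≈ 0#
  coeff-inclX-outside m f x y y≢0 =
    coeff-mapTerms-outside (λ a → a) (_++ zeros m) f (x ++ y) (λ d eq → y≢0 (sym (++-injectiveʳ d x eq)))

  coeff-inclY-outside : ∀ n {m} (g : Pol m) x y → x ≢ zeros n → coeff (inclY n g) (x ++ y) ≈ 0#
  coeff-inclY-outside n g x y x≢0 =
    coeff-mapTerms-outside (λ a → a) (zeros n ++_) g (x ++ y) (λ d eq → x≢0 (sym (++-injectiveˡ (zeros n) x eq)))

  coeff-inclX-zero : ∀ {n} m (f : Pol n) x y → coeff f x ≈ 0# → coeff (inclX m f) (x ++ y) ≈ 0#
  coeff-inclX-zero m f x y fx≈0 with ≡-dec ℕ._≟_ y (zeros m)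
  ... | yes refl = K.trans (coeff-inclX m f x) fx≈0
  ... | no  y≢0  = coeff-inclX-outside m f x y y≢0

  coeff-inclY-zero : ∀ n {m} (g : Pol m) x y → coeff g y ≈ 0# → coeff (inclY n g) (x ++ y) ≈ 0#
  coeff-inclY-zero n g x y gy≈0 with ≡-dec ℕ._≟_ x (zeros n)
  ... | yes refl = K.trans (coeff-inclY n g y) gy≈0
  ... | no  x≢0  = coeff-inclY-outside n g x y x≢0

  support-nonzero : ∀ {r} (h : Pol r) → VanishesAt0 h → ∀ e → NonZero (coeff h e) → e ≢ zeros r
  support-nonzero h h0≈0 e he≉0 refl = he≉0 h0≈0

  module _ {n m} (f : Pol n) (g : Pol m) where

    coeff-⊕-both-zero : ∀ (x : Exp n) (y : Exp m) →
                        coeff (inclX m f) (x ++ y) ≈ 0# → coeff (inclY n g) (x ++ y) ≈ 0# →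
                        coeff (inclX m f ⊕ inclY n g) (x ++ y) ≈ 0#
    coeff-⊕-both-zero x y fxy≈0 gxy≈0 =
      K.trans (coeff-⊕ (inclX m f) (inclY n g) (x ++ y)) (K.trans (K.+-cong fxy≈0 gxy≈0) (K.+-identityˡ 0#))

    zero-⊕ : IsZeroPol f → IsZeroPol g → IsZeroPol (inclX m f ⊕ inclY n g)
    zero-⊕ f≈0 g≈0 e with Vec.splitAt n e
    ... | x , y , refl = coeff-⊕-both-zero x y (coeff-inclX-zero m f x y (f≈0 x)) (coeff-inclY-zero n g x y (g≈0 y))

    support-⊕ˡ : VanishesAt0 f → ∀ x → NonZero (coeff f x) → NonZero (coeff (inclX m f ⊕ inclY n g) (x ++ zeros m))
    support-⊕ˡ f0≈0 x fx≉0 = nonzero-resp (K.sym (begin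
      coeff (inclX m f ⊕ inclY n g) (x ++ zeros m)                      ≈⟨ coeff-⊕ (inclX m f) (inclY n g) _ ⟩
      coeff (inclX m f) (x ++ zeros m) +ₖ coeff (inclY n g) (x ++ zeros m)
        ≈⟨ K.+-cong (coeff-inclX m f x) (coeff-inclY-outside n g x _ (support-nonzero f f0≈0 x fx≉0)) ⟩
      coeff f x +ₖ 0#                                                    ≈⟨ K.+-identityʳ _ ⟩
      coeff f x                                                          ∎)) fx≉0
      where open ≈-Reasoning

    support-⊕ʳ : VanishesAt0 g → ∀ y → NonZero (coeff g y) → NonZero (coeff (inclX m f ⊕ inclY n g) (zeros n ++ y))
    support-⊕ʳ g0≈0 y gy≉0 = nonzero-resp (K.sym (begin
      coeff (inclX m f ⊕ inclY n g) (zeros n ++ y)                      ≈⟨ coeff-⊕ (inclX m f) (inclY n g) _ ⟩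
      coeff (inclX m f) (zeros n ++ y) +ₖ coeff (inclY n g) (zeros n ++ y)
        ≈⟨ K.+-cong (coeff-inclX-outside m f _ y (support-nonzero g g0≈0 y gy≉0)) (coeff-inclY n g y) ⟩
      0# +ₖ coeff g y                                                    ≈⟨ K.+-identityˡ _ ⟩
      coeff g y                                                          ∎)) gy≉0
      where open ≈-Reasoning

    support-⊕ : VanishesAt0 f → VanishesAt0 g →
                ∀ (x : Exp n) (y : Exp m) → NonZero (coeff (inclX m f ⊕ inclY n g) (x ++ y)) →
                (y ≡ zeros m × NonZero (coeff f x)) ⊎ (x ≡ zeros n × NonZero (coeff g y))
    support-⊕ f0≈0 g0≈0 x y s≉0 with ≡-dec ℕ._≟_ y (zeros m) | ≡-dec ℕ._≟_ x (zeros n)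
    ... | yes refl | yes refl = ⊥-elim (s≉0 (coeff-⊕-both-zero x y
                                  (coeff-inclX-zero m f x y f0≈0) (coeff-inclY-zero n g x y g0≈0)))
    ... | yes refl | no  x≢0  = inj₁ (refl , λ fx≈0 → s≉0 (coeff-⊕-both-zero x y
                                  (coeff-inclX-zero m f x y fx≈0) (coeff-inclY-outside n g x y x≢0)))
    ... | no  y≢0  | yes refl = inj₂ (refl , λ gy≈0 → s≉0 (coeff-⊕-both-zero x y
                                  (coeff-inclX-outside m f x y y≢0) (coeff-inclY-zero n g x y gy≈0)))
    ... | no  y≢0  | no  x≢0  = ⊥-elim (s≉0 (coeff-⊕-both-zero x y
                                  (coeff-inclX-outside m f x y y≢0) (coeff-inclY-outside n g x y x≢0)))

  zipWith-+-padded : ∀ {n m} (d : Vec ℕ n) (e : Vec ℕ m) → zipWith ℕ._+_ (d ++ zeros m) (zeros n ++ e) ≡ d ++ e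
  zipWith-+-padded []      []      = refl
  zipWith-+-padded []      (b ∷ e) = cong (b ∷_) (zipWith-+-padded [] e)
  zipWith-+-padded (a ∷ d) e       = cong₂ _∷_ (ℕP.+-identityʳ a) (zipWith-+-padded d e)

  row-⊗ : ∀ {n m} a (d : Exp n) (g : Pol m) →
          List.map (λ (b , e) → (a *ₖ b , zipWith ℕ._+_ (d ++ zeros m) e)) (inclY n g) ≡ mapTerms (a *ₖ_) (d ++_) g
  row-⊗ a d g = trans (sym (ListP.map-∘ g)) (ListP.map-cong (λ (b , e) → cong (a *ₖ b ,_) (zipWith-+-padded d e)) g)

  -- coefficients of f·g multiply, as f and g are in disjoint variables
  coeff-⊗ : ∀ {n m} (f : Pol n) (g : Pol m) x y → coeff (inclX m f ⊗ inclY n g) (x ++ y) ≈ coeff f x *ₖ coeff g y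
  coeff-⊗         []            g x y = K.sym (K.zeroˡ _)
  coeff-⊗ {n} {m} ((a , d) ∷ f) g x y
    with ≡-dec ℕ._≟_ d x
  ... | yes refl = begin
    coeff (row List.++ rest) (d ++ y)                             ≡⟨ cong (λ t → coeff (t List.++ rest) _) (row-⊗ a d g) ⟩
    coeff (mapTerms (a *ₖ_) (d ++_) g List.++ rest) (d ++ y)      ≈⟨ coeff-⊕ (mapTerms (a *ₖ_) (d ++_) g) rest _ ⟩
    coeff (mapTerms (a *ₖ_) (d ++_) g) (d ++ y) +ₖ coeff rest (d ++ y)
      ≈⟨ K.+-cong (coeff-mapTerms-image (a *ₖ_) (d ++_) (K.distribˡ a) (K.zeroʳ a) (++-injectiveʳ d d) g y)
                  (coeff-⊗ f g d y) ⟩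
    a *ₖ coeff g y +ₖ coeff f d *ₖ coeff g y                      ≈⟨ K.sym (K.distribʳ _ a _) ⟩
    (a +ₖ coeff f d) *ₖ coeff g y                                 ∎
    where
    open ≈-Reasoning
    row  = List.map (λ (b , e) → (a *ₖ b , zipWith ℕ._+_ (d ++ zeros m) e)) (inclY n g)
    rest = inclX m f ⊗ inclY n g
  ... | no d≢x = begin
    coeff (row List.++ rest) (x ++ y)                             ≡⟨ cong (λ t → coeff (t List.++ rest) _) (row-⊗ a d g) ⟩
    coeff (mapTerms (a *ₖ_) (d ++_) g List.++ rest) (x ++ y)      ≈⟨ coeff-⊕ (mapTerms (a *ₖ_) (d ++_) g) rest _ ⟩
    coeff (mapTerms (a *ₖ_) (d ++_) g) (x ++ y) +ₖ coeff rest (x ++ y)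
      ≈⟨ K.+-cong (coeff-mapTerms-outside (a *ₖ_) (d ++_) g (x ++ y) (λ e eq → d≢x (++-injectiveˡ d x eq)))
                  (coeff-⊗ f g x y) ⟩
    0# +ₖ coeff f x *ₖ coeff g y                                  ≈⟨ K.+-identityˡ _ ⟩
    coeff f x *ₖ coeff g y                                        ∎
    where
    open ≈-Reasoning
    row  = List.map (λ (b , e) → (a *ₖ b , zipWith ℕ._+_ (d ++ zeros m) e)) (inclY n g)
    rest = inclX m f ⊗ inclY n g

  coeff-head : ∀ {r} a (d : Exp r) h → coeff ((a , d) ∷ h) d ≈ a +ₖ coeff h d
  coeff-head a d h with ≡-dec ℕ._≟_ d d
  ... | yes _   = K.refl
  ... | no  d≢d = ⊥-elim (d≢d refl)

  coeff-head-other : ∀ {r} a (d x : Exp r) h → d ≢ x → coeff ((a , d) ∷ h) x ≈ coeff h x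
  coeff-head-other a d x h d≢x with ≡-dec ℕ._≟_ d x
  ... | yes d≡x = ⊥-elim (d≢x d≡x)
  ... | no  _   = K.refl

  without : ∀ {r} → Exp r → Pol r → Pol r
  without d []             = []
  without d ((a , d′) ∷ h) with ≡-dec ℕ._≟_ d′ d
  ... | yes _ = without d h
  ... | no  _ = (a , d′) ∷ without d h

  -- removing terms does not lengthen the list (the measure of the induction below)
  length-without : ∀ {r} (d : Exp r) h → List.length (without d h) ℕ.≤ List.length h
  length-without d []             = ℕ.z≤n
  length-without d ((a , d′) ∷ h) with ≡-dec ℕ._≟_ d′ d
  ... | yes _ = ℕP.m≤n⇒m≤1+n (length-without d h)
  ... | no  _ = ℕ.s≤s (length-without d h)

  coeff-without-self : ∀ {r} (d : Exp r) h → coeff (without d h) d ≈ 0#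
  coeff-without-self d []             = K.refl
  coeff-without-self d ((a , d′) ∷ h) with ≡-dec ℕ._≟_ d′ d
  ... | yes _    = coeff-without-self d h
  ... | no  d′≢d = K.trans (coeff-head-other a d′ d (without d h) d′≢d) (coeff-without-self d h)

  coeff-without-other : ∀ {r} (d x : Exp r) h → x ≢ d → coeff (without d h) x ≈ coeff h x
  coeff-without-other d x []             x≢d = K.refl
  coeff-without-other d x ((a , d′) ∷ h) x≢d with ≡-dec ℕ._≟_ d′ d | ≡-dec ℕ._≟_ d′ x
  ... | yes refl | yes refl = ⊥-elim (x≢d refl)
  ... | yes _    | no  _    = coeff-without-other d x h x≢d
  ... | no  _    | yes refl = K.trans (coeff-head a d′ (without d h)) (K.+-congˡ (coeff-without-other d x h x≢d))
  ... | no  _    | no  d′≢x = K.trans (coeff-head-other a d′ x (without d h) d′≢x) (coeff-without-other d x h x≢d)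

  coeff-mapExp-fibre : ∀ {r s} (φ : Exp r → Exp s) e d h → φ d ≡ e →
    coeff (mapExp φ h) e ≈ coeff h d +ₖ coeff (mapExp φ (without d h)) e
  coeff-mapExp-fibre φ e d []             φd≡e = K.sym (K.+-identityˡ _)
  coeff-mapExp-fibre φ e d ((a , d′) ∷ h) φd≡e with ≡-dec ℕ._≟_ d′ d
  ... | yes refl with ≡-dec ℕ._≟_ (φ d′) e
  ...   | yes _   = K.trans (K.+-congˡ (coeff-mapExp-fibre φ e d h φd≡e)) (K.sym (K.+-assoc _ _ _))
  ...   | no  φ≢e = ⊥-elim (φ≢e φd≡e)
  coeff-mapExp-fibre φ e d ((a , d′) ∷ h) φd≡e | no _ with ≡-dec ℕ._≟_ (φ d′) e
  ...   | yes _ = begin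
    a +ₖ coeff (mapExp φ h) e                        ≈⟨ K.+-congˡ (coeff-mapExp-fibre φ e d h φd≡e) ⟩
    a +ₖ (coeff h d +ₖ rest)                         ≈⟨ K.sym (K.+-assoc _ _ _) ⟩
    (a +ₖ coeff h d) +ₖ rest                         ≈⟨ K.+-congʳ (K.+-comm _ _) ⟩
    (coeff h d +ₖ a) +ₖ rest                         ≈⟨ K.+-assoc _ _ _ ⟩
    coeff h d +ₖ (a +ₖ rest)                         ∎
    where
    open ≈-Reasoning
    rest = coeff (mapExp φ (without d h)) e
  ...   | no  _ = coeff-mapExp-fibre φ e d h φd≡e

  -- If no exponent over e has a non-zero coefficient in h, then neither has e in
  -- mapExp φ h.  Induction on the number of terms, removing one fibre element at a time.
  mapExp-no-support : ∀ {r s} (φ : Exp r → Exp s) e fuel h → List.length h ℕ.≤ fuel →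
    (∀ d → φ d ≡ e → ¬ NonZero (coeff h d)) → ¬ NonZero (coeff (mapExp φ h) e)
  mapExp-no-support φ e fuel       []            _             _      e≉0 = e≉0 K.refl
  mapExp-no-support φ e (suc fuel) ((a , d) ∷ h) (ℕ.s≤s |h|≤) over-e e≉0 with ≡-dec ℕ._≟_ (φ d) e
  ... | no φd≢e = mapExp-no-support φ e fuel h |h|≤ over-e-tail e≉0
    where
    over-e-tail : ∀ x → φ x ≡ e → ¬ NonZero (coeff h x)
    over-e-tail x φx≡e hx≉0 = over-e x φx≡e
      (nonzero-resp (K.sym (coeff-head-other a d x h (λ d≡x → φd≢e (trans (cong φ d≡x) φx≡e)))) hx≉0)
  ... | yes φd≡e = over-e d φd≡e (λ hd≈0 → rest-zero (λ rest≈0 → e≉0 (begin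
    a +ₖ coeff (mapExp φ h) e                                   ≈⟨ K.+-congˡ (coeff-mapExp-fibre φ e d h φd≡e) ⟩
    a +ₖ (coeff h d +ₖ coeff (mapExp φ (without d h)) e)        ≈⟨ K.sym (K.+-assoc _ _ _) ⟩
    (a +ₖ coeff h d) +ₖ coeff (mapExp φ (without d h)) e
      ≈⟨ K.+-cong (K.trans (K.sym (coeff-head a d h)) hd≈0) rest≈0 ⟩
    0# +ₖ 0#                                                    ≈⟨ K.+-identityˡ 0# ⟩
    0#                                                          ∎)))
    where
    open ≈-Reasoning
    over-e′ : ∀ x → φ x ≡ e → ¬ NonZero (coeff (without d h) x)
    over-e′ x φx≡e with ≡-dec ℕ._≟_ x d
    ... | yes refl = λ x≉0 → x≉0 (coeff-without-self d h)
    ... | no  x≢d  = λ x≉0 → over-e x φx≡e (nonzero-resp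
          (K.trans (coeff-without-other d x h x≢d) (K.sym (coeff-head-other a d x h (λ d≡x → x≢d (sym d≡x))))) x≉0)
    rest-zero : ¬ NonZero (coeff (mapExp φ (without d h)) e)
    rest-zero = mapExp-no-support φ e fuel (without d h) (ℕP.≤-trans (length-without d h) |h|≤) over-e′

  support-mapExp : ∀ {r s} (φ : Exp r → Exp s) h e → NonZero (coeff (mapExp φ h) e) →
                   ¬ ¬ (Σ (Exp r) λ d → φ d ≡ e × NonZero (coeff h d))
  support-mapExp φ h e e≉0 no-preimage =
    mapExp-no-support φ e (List.length h) h ℕP.≤-refl (λ d φd≡e hd≉0 → no-preimage (d , φd≡e , hd≉0)) e≉0

module NewtonWitnesses {c ℓ} (k : Field c ℓ) where
  open Poly k using (Pol; Exp; coeff; InNewton; IsMinDiag; diag)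
  open SupportCalculus k using (NonZero)
  open RationalArithmetic
  open Data.Rational using (_≤_; _*_) renaming (_+_ to _+ℚ_)

  Term : ℕ → Set
  Term r = ℚ × Exp r

  weight : ∀ {r} → List (Term r) → ℚ
  weight ts = sumℚ (List.map proj₁ ts)

  momentTerm : ∀ {r} → Fin r → Term r → ℚ
  momentTerm i (w , e) = w * toℚ (lookup e i)

  moment : ∀ {r} → Fin r → List (Term r) → ℚ
  moment i ts = sumℚ (List.map (momentTerm i) ts)

  Supported : ∀ {r} → Pol r → Term r → Set ℓ
  Supported h (w , e) = 0ℚ ≤ w × NonZero (coeff h e)

  -- A convex combination of support exponents of h lying coordinatewise below B;
  -- for constant B = t this is precisely the statement (t,…,t) ∈ Δ₀(h).
  record Witness {r} (h : Pol r) (B : Fin r → ℚ) : Set ℓ where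
    field
      terms      : List (Term r)
      supported  : All (Supported h) terms
      weight-one : weight terms ≡ 1ℚ
      below      : ∀ i → moment i terms ≤ B i
  open Witness

  witness : ∀ {r} {h : Pol r} {t} → InNewton h (diag r t) → Witness h (λ _ → t)
  witness {t = t} (ts , sup , one , ≤t) = record
    { terms = ts ; supported = sup ; weight-one = one
    ; below = λ i → subst (moment i ts ≤_) (lookup-replicate i t) (≤t i) }

  inNewton : ∀ {r} {h : Pol r} {t} → Witness h (λ _ → t) → InNewton h (diag r t)
  inNewton {t = t} w =
    terms w , supported w , weight-one w , λ i → subst (moment i (terms w) ≤_) (sym (lookup-replicate i t)) (below w i)

  weaken : ∀ {r} {h : Pol r} {B B′} → Witness h B → (∀ i → B i ≤ B′ i) → Witness h B′
  weaken w B≤B′ = record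
    { terms = terms w ; supported = supported w ; weight-one = weight-one w
    ; below = λ i → ℚP.≤-trans (below w i) (B≤B′ i) }

  -- Transfer along a domination of exponents.  A coordinate selector `just j` bounds a
  -- target coordinate by the source coordinate j, and `nothing` forces it to be 0.
  Below : ∀ {r} → Maybe (Fin r) → Exp r → ℕ → Set
  Below nothing  e v = v ≡ 0
  Below (just j) e v = v ℕ.≤ lookup e j

  select : ∀ {r} → Maybe (Fin r) → (Fin r → ℚ) → ℚ
  select nothing  B = 0ℚ
  select (just j) B = B j

  Dominated : ∀ {r s} → Pol s → (Fin s → Maybe (Fin r)) → Exp r → Set ℓ
  Dominated {s = s} h′ J e = Σ (Exp s) λ d → NonZero (coeff h′ d) × (∀ i → Below (J i) e (lookup d i))

  -- If every exponent of a witness for h below B is dominated in h′ along J, then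
  -- replacing each exponent by a dominating one gives a witness for h′ below B ∘ J.
  module Transfer {r s} (h : Pol r) (h′ : Pol s) (J : Fin s → Maybe (Fin r)) where

    replace : (ts : List (Term r)) → All (Dominated h′ J ∘ proj₂) ts → List (Term s)
    replace []             []             = []
    replace ((w , e) ∷ ts) ((d , _) ∷ ds) = (w , d) ∷ replace ts ds

    replace-supported : ∀ ts ds → All (Supported h) ts → All (Supported h′) (replace ts ds)
    replace-supported []             []                  []              = []
    replace-supported ((w , e) ∷ ts) ((d , d≉0 , _) ∷ ds) ((0≤w , _) ∷ ss) = (0≤w , d≉0) ∷ replace-supported ts ds ss

    replace-weight : ∀ ts ds → weight (replace ts ds) ≡ weight ts
    replace-weight []             []       = refl
    replace-weight ((w , e) ∷ ts) (_ ∷ ds) = cong (w +ℚ_) (replace-weight ts ds)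

    contribution : Maybe (Fin r) → Term r → ℚ
    contribution nothing  _ = 0ℚ
    contribution (just j) t = momentTerm j t

    contribution-bound : ∀ sel w e v → 0ℚ ≤ w → Below sel e v → w * toℚ v ≤ contribution sel (w , e)
    contribution-bound nothing  w e .0 0≤w refl = ℚP.≤-reflexive (ℚP.*-zeroʳ w)
    contribution-bound (just j) w e v  0≤w v≤   = *-monoˡ-≤-nonneg 0≤w (toℚ-mono v≤)

    replace-moment : ∀ i ts ds → All (Supported h) ts →
                     moment i (replace ts ds) ≤ sumℚ (List.map (contribution (J i)) ts)
    replace-moment i []             []                []              = ℚP.≤-refl
    replace-moment i ((w , e) ∷ ts) ((d , _ , d≤) ∷ ds) ((0≤w , _) ∷ ss) =
      ℚP.+-mono-≤ (contribution-bound (J i) w e (lookup d i) 0≤w (d≤ i)) (replace-moment i ts ds ss)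

    total-contribution : ∀ {B} (w : Witness h B) sel → sumℚ (List.map (contribution sel) (terms w)) ≤ select sel B
    total-contribution w nothing  = ℚP.≤-reflexive (sumℚ-zero (terms w))
    total-contribution w (just j) = below w j

    transfer : ∀ {B} (w : Witness h B) → All (Dominated h′ J ∘ proj₂) (terms w) →
               Witness h′ (λ i → select (J i) B)
    transfer w ds = record
      { terms      = replace (terms w) ds
      ; supported  = replace-supported (terms w) ds (supported w)
      ; weight-one = trans (replace-weight (terms w) ds) (weight-one w)
      ; below      = λ i → ℚP.≤-trans (replace-moment i (terms w) ds (supported w)) (total-contribution w (J i)) }

    transfer-support : ∀ {B} → (∀ e → NonZero (coeff h e) → Dominated h′ J e) →
                       Witness h B → Witness h′ (λ i → select (J i) B)
    transfer-support dom w = transfer w (All.map (λ (_ , e≉0) → dom _ e≉0) (supported w))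

  open Transfer public using (transfer; transfer-support)

  select-const : ∀ {r} (sel : Maybe (Fin r)) t → 0ℚ ≤ t → select sel (λ _ → t) ≤ t
  select-const nothing  t 0≤t = 0≤t
  select-const (just _) t 0≤t = ℚP.≤-refl

  scaleTerms : ∀ {r} → ℚ → List (Term r) → List (Term r)
  scaleTerms c = List.map (λ (w , e) → (c * w , e))

  scale-supported : ∀ {r} (h : Pol r) c ts → 0ℚ ≤ c → All (Supported h) ts → All (Supported h) (scaleTerms c ts)
  scale-supported h c ts 0≤c ss = AllP.map⁺ (All.map (λ (0≤w , e≉0) → *-nonneg 0≤c 0≤w , e≉0) ss)

  weight-scale : ∀ {r} c (ts : List (Term r)) → weight (scaleTerms c ts) ≡ c * weight ts
  weight-scale c ts = trans (cong sumℚ (sym (ListP.map-∘ ts))) (sumℚ-scale proj₁ c ts)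

  moment-scale : ∀ {r} i c (ts : List (Term r)) → moment i (scaleTerms c ts) ≡ c * moment i ts
  moment-scale i c ts = trans (cong sumℚ (sym (ListP.map-∘ ts)))
    (trans (sumℚ-cong _ _ ts (λ (w , e) → ℚP.*-assoc c w _)) (sumℚ-scale (momentTerm i) c ts))

  combine : ∀ {r} {h : Pol r} {B₁ B₂} (λ′ μ : ℚ) → 0ℚ ≤ λ′ → 0ℚ ≤ μ → λ′ +ℚ μ ≡ 1ℚ →
            Witness h B₁ → Witness h B₂ → Witness h (λ i → λ′ * B₁ i +ℚ μ * B₂ i)
  combine {h = h} λ′ μ 0≤λ 0≤μ λ+μ≡1 w₁ w₂ = record
    { terms      = ts₁ List.++ ts₂
    ; supported  = AllP.++⁺ (scale-supported h λ′ (terms w₁) 0≤λ (supported w₁))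
                            (scale-supported h μ (terms w₂) 0≤μ (supported w₂))
    ; weight-one = begin
        weight (ts₁ List.++ ts₂)
          ≡⟨ sumℚ-++ proj₁ ts₁ ts₂ ⟩
        weight ts₁ +ℚ weight ts₂
          ≡⟨ cong₂ _+ℚ_ (weight-scale λ′ (terms w₁)) (weight-scale μ (terms w₂)) ⟩
        λ′ * weight (terms w₁) +ℚ μ * weight (terms w₂)
          ≡⟨ cong₂ (λ a b → λ′ * a +ℚ μ * b) (weight-one w₁) (weight-one w₂) ⟩
        λ′ * 1ℚ +ℚ μ * 1ℚ                               ≡⟨ cong₂ _+ℚ_ (ℚP.*-identityʳ λ′) (ℚP.*-identityʳ μ) ⟩
        λ′ +ℚ μ                                         ≡⟨ λ+μ≡1 ⟩
        1ℚ                                              ∎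
    ; below      = λ i → subst (_≤ _)
        (sym (trans (sumℚ-++ (momentTerm i) ts₁ ts₂)
                    (cong₂ _+ℚ_ (moment-scale i λ′ (terms w₁)) (moment-scale i μ (terms w₂)))))
        (ℚP.+-mono-≤ (*-monoˡ-≤-nonneg 0≤λ (below w₁ i)) (*-monoˡ-≤-nonneg 0≤μ (below w₂ i))) }
    where
    open ≡-Reasoning
    ts₁ = scaleTerms λ′ (terms w₁)
    ts₂ = scaleTerms μ (terms w₂)

  -- A partial witness: supported terms of total weight Λ lying below (t′,…,t′).  If t is
  -- the diagonal minimum of h then Λ·t ≤ t′, since (1/Λ)·terms is a witness for t′/Λ.
  partial-witness-bound : ∀ {r} {h : Pol r} {t} → IsMinDiag h t → (ts : List (Term r)) → All (Supported h) ts →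
                          ∀ t′ → 0ℚ ≤ t′ → (∀ i → moment i ts ≤ t′) → weight ts * t ≤ t′
  partial-witness-bound {h = h} {t} (0≤t , _ , t-min) ts ss t′ 0≤t′ ts≤t′ with weight ts ℚP.≤? 0ℚ
  ... | yes Λ≤0 = subst (_≤ t′) (sym (trans (cong (_* t) Λ≡0) (ℚP.*-zeroˡ t))) 0≤t′
    where
    Λ≡0 : weight ts ≡ 0ℚ
    Λ≡0 = ℚP.≤-antisym Λ≤0 (sumℚ-nonneg proj₁ ts (All.map proj₁ ss))
  ... | no Λ≰0 with reciprocal (weight ts) (ℚP.≰⇒> Λ≰0)
  ...   | L , ΛL≡1 , 0≤L = begin
    Λ * t              ≤⟨ *-monoˡ-≤-nonneg (ℚP.<⇒≤ (ℚP.≰⇒> Λ≰0))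
                            (t-min (L * t′) (*-nonneg 0≤L 0≤t′) (inNewton normalised)) ⟩
    Λ * (L * t′)       ≡⟨ sym (ℚP.*-assoc Λ L t′) ⟩
    (Λ * L) * t′       ≡⟨ cong (_* t′) ΛL≡1 ⟩
    1ℚ * t′            ≡⟨ ℚP.*-identityˡ t′ ⟩
    t′                 ∎
    where
    open ℚP.≤-Reasoning
    Λ = weight ts
    normalised : Witness h (λ _ → L * t′)
    normalised = record
      { terms      = scaleTerms L ts
      ; supported  = scale-supported h L ts 0≤L ss
      ; weight-one = trans (weight-scale L ts) (trans (ℚP.*-comm L Λ) ΛL≡1)
      ; below      = λ i → subst (_≤ L * t′) (sym (moment-scale i L ts)) (*-monoˡ-≤-nonneg 0≤L (ts≤t′ i)) }

module SigmaOfSum {c ℓ} (k : Field c ℓ) {n m} (f : Poly.Pol k n) (g : Poly.Pol k m)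
                  (f0≈0 : Poly.VanishesAt0 k f) (g0≈0 : Poly.VanishesAt0 k g) where
  open Poly k hiding (toℚ; sumℚ)
  open SupportCalculus k
  open NewtonWitnesses k
  open Witness
  open RationalArithmetic
  open Data.Rational using (_≤_; _*_) renaming (_+_ to _+ℚ_)

  S : Pol (n + m)
  S = inclX m f ⊕ inclY n g

  xBlock : Fin (n + m) → Maybe (Fin n)
  xBlock i = [ just , (λ _ → nothing) ]′ (splitAt n i)

  yBlock : Fin (n + m) → Maybe (Fin m)
  yBlock i = [ (λ _ → nothing) , just ]′ (splitAt n i)

  dominated-x : ∀ x → NonZero (coeff f x) → Dominated S xBlock x
  dominated-x x fx≉0 = x ++ zeros m , support-⊕ˡ f g f0≈0 x fx≉0 , below-x
    where
    below-x : ∀ i → Below (xBlock i) x (lookup (x ++ zeros m) i)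
    below-x i rewrite lookup-++-splitAt x (zeros m) i with splitAt n i
    ... | inj₁ j = ℕP.≤-refl
    ... | inj₂ j = lookup-replicate j 0

  dominated-y : ∀ y → NonZero (coeff g y) → Dominated S yBlock y
  dominated-y y gy≉0 = zeros n ++ y , support-⊕ʳ f g g0≈0 y gy≉0 , below-y
    where
    below-y : ∀ i → Below (yBlock i) y (lookup (zeros n ++ y) i)
    below-y i rewrite lookup-++-splitAt (zeros n) y i with splitAt n i
    ... | inj₁ j = lookup-replicate j 0
    ... | inj₂ j = ℕP.≤-refl

  reach-x : ∀ {t} → 0ℚ ≤ t → InNewton f (diag n t) → InNewton S (diag (n + m) t)
  reach-x 0≤t t∈Δf = inNewton (weaken (transfer-support f S xBlock dominated-x (witness t∈Δf))
                                       (λ i → select-const (xBlock i) _ 0≤t))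

  reach-y : ∀ {t} → 0ℚ ≤ t → InNewton g (diag m t) → InNewton S (diag (n + m) t)
  reach-y 0≤t t∈Δg = inNewton (weaken (transfer-support g S yBlock dominated-y (witness t∈Δg))
                                       (λ i → select-const (yBlock i) _ 0≤t))

  -- when g = 0 the support of S is supp f × {0}, and symmetrically
  min-S-g-zero : IsZeroPol g → ∀ {t} → IsMinDiag f t → IsMinDiag S t
  min-S-g-zero g≈0 (0≤t , t∈Δf , t-min) = 0≤t , reach-x 0≤t t∈Δf , λ t′ 0≤t′ t′∈ΔS →
    t-min t′ 0≤t′ (inNewton (transfer-support S f (λ j → just (j ↑ˡ m)) back (witness t′∈ΔS)))
    where
    back : ∀ e → NonZero (coeff S e) → Dominated f (λ j → just (j ↑ˡ m)) e
    back e e≉0 with Vec.splitAt n e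
    ... | x , y , refl with support-⊕ f g f0≈0 g0≈0 x y e≉0
    ...   | inj₁ (_ , fx≉0) = x , fx≉0 , λ j → ℕP.≤-reflexive (sym (lookup-++ˡ x y j))
    ...   | inj₂ (_ , gy≉0) = ⊥-elim (gy≉0 (g≈0 y))

  min-S-f-zero : IsZeroPol f → ∀ {t} → IsMinDiag g t → IsMinDiag S t
  min-S-f-zero f≈0 (0≤t , t∈Δg , t-min) = 0≤t , reach-y 0≤t t∈Δg , λ t′ 0≤t′ t′∈ΔS →
    t-min t′ 0≤t′ (inNewton (transfer-support S g (λ j → just (n ↑ʳ j)) back (witness t′∈ΔS)))
    where
    back : ∀ e → NonZero (coeff S e) → Dominated g (λ j → just (n ↑ʳ j)) e
    back e e≉0 with Vec.splitAt n e
    ... | x , y , refl with support-⊕ f g f0≈0 g0≈0 x y e≉0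
    ...   | inj₁ (_ , fx≉0) = ⊥-elim (fx≉0 (f≈0 x))
    ...   | inj₂ (_ , gy≉0) = y , gy≉0 , λ j → ℕP.≤-reflexive (sym (lookup-++ʳ x y j))

  min-S-origin-x : IsMinDiag f 0ℚ → IsMinDiag S 0ℚ
  min-S-origin-x (0≤0 , 0∈Δf , _) = 0≤0 , reach-x 0≤0 0∈Δf , λ t′ 0≤t′ _ → 0≤t′

  min-S-origin-y : IsMinDiag g 0ℚ → IsMinDiag S 0ℚ
  min-S-origin-y (0≤0 , 0∈Δg , _) = 0≤0 , reach-y 0≤0 0∈Δg , λ t′ 0≤t′ _ → 0≤t′

  record Split (ts : List (Term (n + m))) : Set ℓ where
    field
      xTerms      : List (Term n)
      yTerms      : List (Term m)
      x-supported : All (Supported f) xTerms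
      y-supported : All (Supported g) yTerms
      weight-sum  : weight xTerms +ℚ weight yTerms ≡ weight ts
      x-moment    : ∀ j → moment j xTerms ≤ moment (j ↑ˡ m) ts
      y-moment    : ∀ j → moment j yTerms ≤ moment (n ↑ʳ j) ts
  open Split

  -- sort each term by the summand its exponent comes from (supp S is a disjoint union)
  split : ∀ ts → All (Supported S) ts → Split ts
  split [] [] = record
    { xTerms = [] ; yTerms = [] ; x-supported = [] ; y-supported = [] ; weight-sum = refl
    ; x-moment = λ _ → ℚP.≤-refl ; y-moment = λ _ → ℚP.≤-refl }
  split ((w , e) ∷ ts) ((0≤w , e≉0) ∷ ss) with Vec.splitAt n e | split ts ss
  ... | x , y , refl | R with support-⊕ f g f0≈0 g0≈0 x y e≉0
  ...   | inj₁ (_ , fx≉0) = record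
    { xTerms = (w , x) ∷ xTerms R ; yTerms = yTerms R
    ; x-supported = (0≤w , fx≉0) ∷ x-supported R ; y-supported = y-supported R
    ; weight-sum = trans (ℚP.+-assoc w _ _) (cong (w +ℚ_) (weight-sum R))
    ; x-moment = λ j → ℚP.+-mono-≤ (ℚP.≤-reflexive (cong (λ v → w * toℚ v) (sym (lookup-++ˡ x y j)))) (x-moment R j)
    ; y-moment = λ j → subst (_≤ _) (ℚP.+-identityˡ _)
                   (ℚP.+-mono-≤ (*-nonneg 0≤w (toℚ-nonneg (lookup (x ++ y) (n ↑ʳ j)))) (y-moment R j)) }
  ...   | inj₂ (_ , gy≉0) = record
    { xTerms = xTerms R ; yTerms = (w , y) ∷ yTerms R
    ; x-supported = x-supported R ; y-supported = (0≤w , gy≉0) ∷ y-supported R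
    ; weight-sum = trans (ℚP.+-comm (weight (xTerms R)) _)
                   (trans (ℚP.+-assoc w _ _) (cong (w +ℚ_) (trans (ℚP.+-comm (weight (yTerms R)) _) (weight-sum R))))
    ; x-moment = λ j → subst (_≤ _) (ℚP.+-identityˡ _)
                   (ℚP.+-mono-≤ (*-nonneg 0≤w (toℚ-nonneg (lookup (x ++ y) (j ↑ˡ m)))) (x-moment R j))
    ; y-moment = λ j → ℚP.+-mono-≤ (ℚP.≤-reflexive (cong (λ v → w * toℚ v) (sym (lookup-++ʳ x y j)))) (y-moment R j) }

  min-S : ∀ {tf qf tg qg t} → IsMinDiag f tf → tf * qf ≡ 1ℚ → IsMinDiag g tg → tg * qg ≡ 1ℚ →
          0ℚ ≤ t → t * (qf +ℚ qg) ≡ 1ℚ → IsMinDiag S t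
  min-S {tf} {qf} {tg} {qg} {t} (0≤tf , tf∈Δf , tf-min) tfqf≡1 (0≤tg , tg∈Δg , tg-min) tgqg≡1 0≤t t[qf+qg]≡1 =
    0≤t , inNewton (weaken mixed mixed≤t) , t-min
    where
    0≤qf = ℚP.<⇒≤ (reciprocal-pos 0≤tf tfqf≡1)
    0≤qg = ℚP.<⇒≤ (reciprocal-pos 0≤tg tgqg≡1)

    mixed = combine (t * qf) (t * qg) (*-nonneg 0≤t 0≤qf) (*-nonneg 0≤t 0≤qg)
              (trans (sym (ℚP.*-distribˡ-+ t qf qg)) t[qf+qg]≡1)
              (transfer-support f S xBlock dominated-x (witness tf∈Δf))
              (transfer-support g S yBlock dominated-y (witness tg∈Δg))

    mixed≤t : ∀ i → (t * qf) * select (xBlock i) (λ _ → tf) +ℚ (t * qg) * select (yBlock i) (λ _ → tg) ≤ t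
    mixed≤t i with splitAt n i
    ... | inj₁ _ = ℚP.≤-reflexive (trans (cong ((t * qf) * tf +ℚ_) (ℚP.*-zeroʳ (t * qg)))
                     (trans (ℚP.+-identityʳ _) (cancel-reciprocal {s = tf} t tfqf≡1)))
    ... | inj₂ _ = ℚP.≤-reflexive (trans (cong (_+ℚ (t * qg) * tg) (ℚP.*-zeroʳ (t * qf)))
                     (trans (ℚP.+-identityˡ _) (cancel-reciprocal {s = tg} t tgqg≡1)))

    -- any witness for S at t′ has f-part Λf ≤ t′·qf and g-part Λg ≤ t′·qg with Λf + Λg = 1
    t-min : ∀ t′ → 0ℚ ≤ t′ → InNewton S (diag (n + m) t′) → t ≤ t′
    t-min t′ 0≤t′ t′∈ΔS = below-reciprocal t[qf+qg]≡1 0≤t (begin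
      1ℚ                                   ≡⟨ sym (trans (weight-sum R) (weight-one w)) ⟩
      weight (xTerms R) +ℚ weight (yTerms R)
        ≤⟨ ℚP.+-mono-≤ (divide-by-reciprocal {Λ = weight (xTerms R)} {t = tf} tfqf≡1 0≤qf Λf·tf≤t′)
                       (divide-by-reciprocal {Λ = weight (yTerms R)} {t = tg} tgqg≡1 0≤qg Λg·tg≤t′) ⟩
      t′ * qf +ℚ t′ * qg                     ≡⟨ sym (ℚP.*-distribˡ-+ t′ qf qg) ⟩
      t′ * (qf +ℚ qg)                        ∎)
      where
      open ℚP.≤-Reasoning
      w : Witness S (λ _ → t′)
      w = witness t′∈ΔS
      R = split (terms w) (supported w)
      Λf·tf≤t′ : weight (xTerms R) * tf ≤ t′
      Λf·tf≤t′ = partial-witness-bound {h = f} (0≤tf , tf∈Δf , tf-min) (xTerms R) (x-supported R) t′ 0≤t′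
                   (λ j → ℚP.≤-trans (x-moment R j) (below w _))
      Λg·tg≤t′ : weight (yTerms R) * tg ≤ t′
      Λg·tg≤t′ = partial-witness-bound {h = g} (0≤tg , tg∈Δg , tg-min) (yTerms R) (y-supported R) t′ 0≤t′
                   (λ j → ℚP.≤-trans (y-moment R j) (below w _))

  σ-sum : ∀ σf σg → HasSigma f σf → HasSigma g σg → HasSigma S (σf +∞ σg)
  σ-sum _ _ (σ-zero f≈0) (σ-zero g≈0) = σ-zero (zero-⊕ f g f≈0 g≈0)
  σ-sum _ _ (σ-zero f≈0) (σ-inf {y} gy≉0 g-min) = σ-inf (support-⊕ʳ f g g0≈0 y gy≉0) (min-S-origin-y g-min)
  σ-sum _ _ (σ-zero f≈0) (σ-fin {y} {q = qg} gy≉0 g-min tg≢0 tgqg≡1) =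
    subst (HasSigma S ∘ fin) (sym (ℚP.+-identityˡ qg))
          (σ-fin (support-⊕ʳ f g g0≈0 y gy≉0) (min-S-f-zero f≈0 g-min) tg≢0 tgqg≡1)
  σ-sum _ _ (σ-inf {x} fx≉0 f-min) _ = σ-inf (support-⊕ˡ f g f0≈0 x fx≉0) (min-S-origin-x f-min)
  σ-sum _ _ (σ-fin {x} {q = qf} fx≉0 f-min tf≢0 tfqf≡1) (σ-zero g≈0) =
    subst (HasSigma S ∘ fin) (sym (ℚP.+-identityʳ qf))
          (σ-fin (support-⊕ˡ f g f0≈0 x fx≉0) (min-S-g-zero g≈0 f-min) tf≢0 tfqf≡1)
  σ-sum _ _ (σ-fin _ _ _ _) (σ-inf {y} gy≉0 g-min) = σ-inf (support-⊕ʳ f g g0≈0 y gy≉0) (min-S-origin-y g-min)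
  σ-sum _ _ (σ-fin {x} {q = qf} fx≉0 f-min _ tfqf≡1) (σ-fin {q = qg} _ g-min _ tgqg≡1)
    with reciprocal (qf +ℚ qg) (ℚP.+-mono-<-≤ (reciprocal-pos (proj₁ f-min) tfqf≡1)
                                            (ℚP.<⇒≤ (reciprocal-pos (proj₁ g-min) tgqg≡1)))
  ... | t , [qf+qg]t≡1 , 0≤t =
    σ-fin (support-⊕ˡ f g f0≈0 x fx≉0) (min-S f-min tfqf≡1 g-min tgqg≡1 0≤t t[qf+qg]≡1)
          (reciprocal-nonzero t[qf+qg]≡1) t[qf+qg]≡1
    where
    t[qf+qg]≡1 : t * (qf +ℚ qg) ≡ 1ℚ
    t[qf+qg]≡1 = trans (ℚP.*-comm t (qf +ℚ qg)) [qf+qg]t≡1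

module SigmaOfProduct {c ℓ} (k : Field c ℓ) {n m} (f : Poly.Pol k n) (g : Poly.Pol k m) where
  open Poly k hiding (toℚ; sumℚ)
  open SupportCalculus k
  open NewtonWitnesses k
  open Witness
  open RationalArithmetic
  open Data.Rational using (_≤_; _*_) renaming (_+_ to _+ℚ_)

  P : Pol (n + m)
  P = inclX m f ⊗ inclY n g

  nonzero-P : ∀ x y → NonZero (coeff f x) → NonZero (coeff g y) → NonZero (coeff P (x ++ y))
  nonzero-P x y fx≉0 gy≉0 = nonzero-resp (K.sym (coeff-⊗ f g x y)) (nonzero-* _ _ fx≉0 gy≉0)

  support-P : ∀ x y → NonZero (coeff P (x ++ y)) → NonZero (coeff f x) × NonZero (coeff g y)
  support-P x y p≉0 = nonzero-*ˡ _ _ fxgy≉0 , nonzero-*ʳ _ _ fxgy≉0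
    where fxgy≉0 = nonzero-resp (coeff-⊗ f g x y) p≉0

  zero-P-f : IsZeroPol f → IsZeroPol P
  zero-P-f f≈0 e with Vec.splitAt n e
  ... | x , y , refl = K.trans (coeff-⊗ f g x y) (K.trans (K.*-congʳ (f≈0 x)) (K.zeroˡ _))

  zero-P-g : IsZeroPol g → IsZeroPol P
  zero-P-g g≈0 e with Vec.splitAt n e
  ... | x , y , refl = K.trans (coeff-⊗ f g x y) (K.trans (K.*-congˡ (g≈0 y)) (K.zeroʳ _))

  productTerms : List (Term n) → List (Term m) → List (Term (n + m))
  productTerms = cartesianProductWith (λ (w , x) (v , y) → (w * v , x ++ y))

  product-supported : ∀ ws vs → All (Supported f) ws → All (Supported g) vs → All (Supported P) (productTerms ws vs)
  product-supported ws vs ws-sup vs-sup =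
    AllP.cartesianProductWith⁺ (setoid _) (setoid _) _ ws vs λ w∈ v∈ →
      supported-pair (All.lookup ws-sup w∈) (All.lookup vs-sup v∈)
    where
    supported-pair : ∀ {p q} → Supported f p → Supported g q → Supported P (proj₁ p * proj₁ q , proj₂ p ++ proj₂ q)
    supported-pair (0≤w , x≉0) (0≤v , y≉0) = *-nonneg 0≤w 0≤v , nonzero-P _ _ x≉0 y≉0

  product-weight : ∀ ws vs → weight (productTerms ws vs) ≡ weight ws * weight vs
  product-weight = sumℚ-cartesian _ proj₁ proj₁ proj₁ (λ _ _ → refl)

  product-moment-x : ∀ i j → splitAt n i ≡ inj₁ j →
                     ∀ ws vs → moment i (productTerms ws vs) ≡ moment j ws * weight vs
  product-moment-x i j i≡j = sumℚ-cartesian _ (momentTerm i) (momentTerm j) proj₁ λ (w , x) (v , y) →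
    trans (cong (λ a → (w * v) * toℚ a) (trans (lookup-++-splitAt x y i) (cong [ lookup x , lookup y ]′ i≡j)))
          (trans (ℚP.*-assoc w v _) (trans (cong (w *_) (ℚP.*-comm v _)) (sym (ℚP.*-assoc w _ v))))

  product-moment-y : ∀ i j → splitAt n i ≡ inj₂ j →
                     ∀ ws vs → moment i (productTerms ws vs) ≡ weight ws * moment j vs
  product-moment-y i j i≡j = sumℚ-cartesian _ (momentTerm i) proj₁ (momentTerm j) λ (w , x) (v , y) →
    trans (cong (λ a → (w * v) * toℚ a) (trans (lookup-++-splitAt x y i) (cong [ lookup x , lookup y ]′ i≡j)))
          (ℚP.*-assoc w v _)

  product-witness : ∀ {tf tg T} → Witness f (λ _ → tf) → Witness g (λ _ → tg) → tf ≤ T → tg ≤ T →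
                    Witness P (λ _ → T)
  product-witness {tf} {tg} {T} wf wg tf≤T tg≤T = record
    { terms      = productTerms (terms wf) (terms wg)
    ; supported  = product-supported (terms wf) (terms wg) (supported wf) (supported wg)
    ; weight-one = trans (product-weight (terms wf) (terms wg)) (cong₂ _*_ (weight-one wf) (weight-one wg))
    ; below      = product-below }
    where
    product-below : ∀ i → moment i (productTerms (terms wf) (terms wg)) ≤ T
    product-below i with splitAt n i in i≡
    ... | inj₁ j = ℚP.≤-trans (ℚP.≤-reflexive (trans (product-moment-x i j i≡ (terms wf) (terms wg))
                     (trans (cong (moment j (terms wf) *_) (weight-one wg)) (ℚP.*-identityʳ _))))
                     (ℚP.≤-trans (below wf j) tf≤T)
    ... | inj₂ j = ℚP.≤-trans (ℚP.≤-reflexive (trans (product-moment-y i j i≡ (terms wf) (terms wg))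
                     (trans (cong (_* moment j (terms wg)) (weight-one wf)) (ℚP.*-identityˡ _))))
                     (ℚP.≤-trans (below wg j) tg≤T)

  dominated-x : ∀ e → NonZero (coeff P e) → Dominated f (λ j → just (j ↑ˡ m)) e
  dominated-x e e≉0 with Vec.splitAt n e
  ... | x , y , refl = x , proj₁ (support-P x y e≉0) , λ j → ℕP.≤-reflexive (sym (lookup-++ˡ x y j))

  dominated-y : ∀ e → NonZero (coeff P e) → Dominated g (λ j → just (n ↑ʳ j)) e
  dominated-y e e≉0 with Vec.splitAt n e
  ... | x , y , refl = y , proj₂ (support-P x y e≉0) , λ j → ℕP.≤-reflexive (sym (lookup-++ʳ x y j))

  min-P : ∀ {tf tg} T → IsMinDiag f tf → IsMinDiag g tg → tf ≤ T → tg ≤ T → T ≡ tf ⊎ T ≡ tg →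
          IsMinDiag P T
  min-P {tf} {tg} T (0≤tf , tf∈Δf , tf-min) (0≤tg , tg∈Δg , tg-min) tf≤T tg≤T T≡ =
    ℚP.≤-trans 0≤tf tf≤T , inNewton (product-witness (witness tf∈Δf) (witness tg∈Δg) tf≤T tg≤T) , T-min T≡
    where
    T-min : T ≡ tf ⊎ T ≡ tg → ∀ t′ → 0ℚ ≤ t′ → InNewton P (diag (n + m) t′) → T ≤ t′
    T-min (inj₁ refl) t′ 0≤t′ t′∈ΔP =
      tf-min t′ 0≤t′ (inNewton (transfer-support P f (λ j → just (j ↑ˡ m)) dominated-x (witness t′∈ΔP)))
    T-min (inj₂ refl) t′ 0≤t′ t′∈ΔP =
      tg-min t′ 0≤t′ (inNewton (transfer-support P g (λ j → just (n ↑ʳ j)) dominated-y (witness t′∈ΔP)))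

  σ-product : ∀ σf σg → HasSigma f σf → HasSigma g σg → HasSigma P (min∞ σf σg)
  σ-product _ _ (σ-zero f≈0) (σ-zero _) =
    subst (HasSigma P ∘ fin) (sym (ℚP.p≤q⇒p⊓q≡p (ℚP.≤-refl {0ℚ}))) (σ-zero (zero-P-f f≈0))
  σ-product _ _ (σ-zero f≈0) (σ-inf _ _) = σ-zero (zero-P-f f≈0)
  σ-product _ _ (σ-zero f≈0) (σ-fin _ g-min _ tgqg≡1) =
    subst (HasSigma P ∘ fin) (sym (ℚP.p≤q⇒p⊓q≡p (ℚP.<⇒≤ (reciprocal-pos (proj₁ g-min) tgqg≡1))))
          (σ-zero (zero-P-f f≈0))
  σ-product _ _ (σ-inf _ _) (σ-zero g≈0) = σ-zero (zero-P-g g≈0)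
  σ-product _ _ (σ-fin _ f-min _ tfqf≡1) (σ-zero g≈0) =
    subst (HasSigma P ∘ fin) (sym (ℚP.p≥q⇒p⊓q≡q (ℚP.<⇒≤ (reciprocal-pos (proj₁ f-min) tfqf≡1))))
          (σ-zero (zero-P-g g≈0))
  σ-product _ _ (σ-inf {x} fx≉0 f-min) (σ-inf {y} gy≉0 g-min) =
    σ-inf (nonzero-P x y fx≉0 gy≉0) (min-P 0ℚ f-min g-min ℚP.≤-refl ℚP.≤-refl (inj₁ refl))
  σ-product _ _ (σ-inf {x} fx≉0 f-min) (σ-fin {y} gy≉0 g-min tg≢0 tgqg≡1) =
    σ-fin (nonzero-P x y fx≉0 gy≉0) (min-P _ f-min g-min (proj₁ g-min) ℚP.≤-refl (inj₂ refl)) tg≢0 tgqg≡1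
  σ-product _ _ (σ-fin {x} fx≉0 f-min tf≢0 tfqf≡1) (σ-inf {y} gy≉0 g-min) =
    σ-fin (nonzero-P x y fx≉0 gy≉0) (min-P _ f-min g-min ℚP.≤-refl (proj₁ f-min) (inj₁ refl)) tf≢0 tfqf≡1
  σ-product _ _ (σ-fin {x} {tf} {qf} fx≉0 f-min tf≢0 tfqf≡1) (σ-fin {y} {tg} {qg} gy≉0 g-min tg≢0 tgqg≡1)
    with qf ℚP.≤? qg
  ... | yes qf≤qg = subst (HasSigma P ∘ fin) (sym (ℚP.p≤q⇒p⊓q≡p qf≤qg))
    (σ-fin (nonzero-P x y fx≉0 gy≉0) (min-P tf f-min g-min ℚP.≤-refl tg≤tf (inj₁ refl)) tf≢0 tfqf≡1)
    where tg≤tf = reciprocal-antitone⁻¹ (proj₁ f-min) tfqf≡1 tgqg≡1 qf≤qg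
  ... | no qf≰qg = subst (HasSigma P ∘ fin) (sym (ℚP.p≥q⇒p⊓q≡q qg≤qf))
    (σ-fin (nonzero-P x y fx≉0 gy≉0) (min-P tg f-min g-min tf≤tg ℚP.≤-refl (inj₂ refl)) tg≢0 tgqg≡1)
    where
    qg≤qf = ℚP.<⇒≤ (ℚP.≰⇒> qf≰qg)
    tf≤tg = reciprocal-antitone⁻¹ (proj₁ g-min) tgqg≡1 tfqf≡1 qg≤qf

module SigmaOfSubstitution {c ℓ} (k : Field c ℓ) {n} (f : Poly.Pol k (suc (suc n))) where
  open Poly k hiding (toℚ; sumℚ)
  open SupportCalculus k
  open NewtonWitnesses k
  open RationalArithmetic
  open Data.Rational using (_≤_)

  h : Pol (suc n)
  h = substLast f

  -- the coordinate of a merged exponent that contains coordinate i of the original one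
  mergedCoordinate : ∀ n → Fin (suc (suc n)) → Fin (suc n)
  mergedCoordinate zero    zero    = zero
  mergedCoordinate zero    (suc _) = zero
  mergedCoordinate (suc n) zero    = zero
  mergedCoordinate (suc n) (suc i) = suc (mergedCoordinate n i)

  merge-enlarges : ∀ n (d : Exp (suc (suc n))) i → lookup d i ℕ.≤ lookup (mergeLast d) (mergedCoordinate n i)
  merge-enlarges zero    (a ∷ b ∷ []) zero       = ℕP.m≤m+n a b
  merge-enlarges zero    (a ∷ b ∷ []) (suc zero) = ℕP.m≤n+m b a
  merge-enlarges (suc n) (a ∷ d)      zero       = ℕP.≤-refl
  merge-enlarges (suc n) (a ∷ d)      (suc i)    = merge-enlarges n d i

  dominated : ∀ e → NonZero (coeff h e) → ¬ ¬ Dominated f (just ∘ mergedCoordinate n) e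
  dominated e e≉0 not-dominated = support-mapExp mergeLast f e e≉0 λ (d , merge-d≡e , d≉0) →
    not-dominated (d , d≉0 , λ i →
      subst (λ e′ → lookup d i ℕ.≤ lookup e′ (mergedCoordinate n i)) merge-d≡e (merge-enlarges n d i))

  -- so a witness for h at (th,…,th) gives one for f, whence tf ≤ th (≤ on ℚ is decidable)
  min-le : ∀ {tf th} → IsMinDiag f tf → IsMinDiag h th → tf ≤ th
  min-le {tf} {th} (_ , _ , tf-min) (0≤th , th∈Δh , _) = decidable-stable (tf ℚP.≤? th) λ tf≰th →
    ¬¬-all (Witness.terms w) (All.map (λ (_ , e≉0) → dominated _ e≉0) (Witness.supported w)) λ ds →
      tf≰th (tf-min th 0≤th (inNewton (transfer h f (just ∘ mergedCoordinate n) w ds)))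
    where
    w : Witness h (λ _ → th)
    w = witness th∈Δh

  -- claim (iii): the reciprocals reverse tf ≤ th; f = 0 forces h = 0
  σ-substitution : ∀ σf σh → HasSigma f σf → HasSigma h σh → σh ≤∞ σf
  σ-substitution _ _ (σ-zero _)             (σ-zero _) = fin≤fin ℚP.≤-refl
  σ-substitution _ _ (σ-inf _ _)            (σ-zero _) = ≤∞-top
  σ-substitution _ _ (σ-fin _ f-min _ tfqf≡1) (σ-zero _) = fin≤fin (ℚP.<⇒≤ (reciprocal-pos (proj₁ f-min) tfqf≡1))
  σ-substitution _ _ (σ-zero f≈0)           (σ-inf {e} e≉0 _) =
    ⊥-elim (support-mapExp mergeLast f e e≉0 λ (d , _ , d≉0) → d≉0 (f≈0 d))
  σ-substitution _ _ (σ-zero f≈0)           (σ-fin {e} e≉0 _ _ _) =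
    ⊥-elim (support-mapExp mergeLast f e e≉0 λ (d , _ , d≉0) → d≉0 (f≈0 d))
  σ-substitution _ _ (σ-inf _ _)            _ = ≤∞-top
  σ-substitution _ _ (σ-fin _ f-min tf≢0 _) (σ-inf _ h-min) =
    ⊥-elim (tf≢0 (ℚP.≤-antisym (min-le f-min h-min) (proj₁ f-min)))
  σ-substitution _ _ (σ-fin _ f-min _ tfqf≡1) (σ-fin _ h-min _ thqh≡1) =
    fin≤fin (reciprocal-antitone (proj₁ f-min) tfqf≡1 thqh≡1 (min-le f-min h-min))

-- The lemma: (i) and (ii) for f, g vanishing at the origin; (iii) needs no hypothesis on f.
lemma2p2p1 : ∀ {c ℓ : Level} (k : Field c ℓ) → let open Poly k in
    (∀ (n m : ℕ) (f : Pol n) (g : Pol m) → VanishesAt0 f → VanishesAt0 g →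
       ∀ (σf σg : ℚ∞) → HasSigma f σf → HasSigma g σg →
         HasSigma (inclX m f ⊕ inclY n g) (σf +∞ σg)
       × HasSigma (inclX m f ⊗ inclY n g) (min∞ σf σg))
  × (∀ (n : ℕ) (f : Pol (suc (suc n))) → VanishesAt0 f →
       ∀ (σf σh : ℚ∞) → HasSigma f σf → HasSigma (substLast f) σh →
         σh ≤∞ σf)
lemma2p2p1 k =
    (λ n m f g f0≈0 g0≈0 σf σg f-σ g-σ →
       SigmaOfSum.σ-sum k f g f0≈0 g0≈0 σf σg f-σ g-σ , SigmaOfProduct.σ-product k f g σf σg f-σ g-σ)
  , (λ n f _ σf σh f-σ h-σ → SigmaOfSubstitution.σ-substitution k f σf σh f-σ h-σ)
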